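{- Assume the state set $S$ is nonempty. Let $(\gamma,x_0)$ and $(\delta,y_0)$ be based, reachable cellular automata, with $\gamma\colon X\to CX$ and $\delta\colon Y\to CY$, and suppose that the action of $\gamma$ is free, i.e. $\gamma_1(x)\colon M\to X$ is injective for every $x\in X$. Let $t\colon X^*\to Y^*$ be a logical transport $(\gamma,x_0)\rightsquigarrow(\delta,y_0)$. Then there exists a unique based cellular morphism $(\gamma,x_0)\to(\delta,y_0)$ whose second component is $t$; that is, there is a unique based pre-cellular morphism $f\colon(\gamma,x_0)\to(\delta,y_0)$ such that $(f,t)$ is a cellular morphism, i.e. such that $t(c)\circ f=c$ for all $c\in X^*$.
   Context: Fix a monoid $(M,\cdot,e)$, a subset $N\subseteq M$ (the neighbourhood) with inclusion $i\colon N\hookrightarrow M$, and a set $S$ of states. $[A,B]$ denotes the set of all maps $A\to B$. For a map $a\colon M\to X$ let $I^a\subseteq[N,S]$ be the set of maps $f\colon N\to S$ such that $f(n)=f(n')$ whenever $n,n'\in N$ satisfy $a(i(n))=a(i(n'))$; for $h\colon X\to Y$ one has $I^{h\circ a}\subseteq I^a$. Let $C$ be the endofunctor on sets with $CX=\coprod_{a\colon M\to X}[I^a,S]$ and $(Ch)(a,f)=(h\circ a,\ f|_{I^{h\circ a}})$. A cellular automaton is a map $\gamma\colon X\to CX$, written $\gamma(x)=(\gamma_1(x),\gamma_2(x))$ with $\gamma_1(x)\colon M\to X$, $\gamma_2(x)\colon I^{\gamma_1(x)}\to S$, such that $\gamma_1(x)(e)=x$ and $\gamma_1(\gamma_1(x)(m))(n)=\gamma_1(x)(n\cdot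 m)$ for all $x\in X$, $m,n\in M$. A pre-cellular morphism $h\colon\gamma\to\delta$ (with $\delta\colon Y\to CY$ a cellular automaton) is a map $h\colon X\to Y$ with $Ch\circ\gamma=\delta\circ h$, i.e. $h(\gamma_1(x)(m))=\delta_1(h(x))(m)$ and $\delta_2(h(x))(f)=\gamma_2(x)(f)$ for all $f\in I^{\delta_1(h(x))}$. A configuration of $\gamma$ is a map $c\colon X\to S$; write $X^*=[X,S]$, and for $h\colon X\to Y$ let $h^*\colon Y^*\to X^*$, $h^*(c)=c\circ h$. The global rule $G_\gamma\colon X^*\to X^*$ is $G_\gamma(c)(x)=\gamma_2(x)(c\circ\gamma_1(x)\circ i)$. A cellular morphism $\gamma\to\delta$ is a pair $(f,s)$ with $f$ a pre-cellular morphism and $s\colon X^*\to Y^*$ with $f^*\circ s=\mathrm{id}$. A based cellular automaton is a pair $(\gamma,x_0)$ with $x_0\in X$; it is reachable if $\gamma_1(x_0)\colon M\to X$ is surjective; a (pre-)cellular morphism $(f,s)$ or $f$ is based $(\gamma,x_0)\to(\delta,y_0)$ if $f(x_0)=y_0$. Modal formulas are generated by $\varphi::=s\mid\neg\varphi\mid\bigvee_{j\in J}\varphi_j\mid\langle m\rangle\varphi\mid\bigcirc\varphi$ with $s\in S$, $m\in M$, $J$ an arbitrary index set. For a cellular automaton $\gamma\colon X\to CX$, $x\in X$, $c\in X^*$: $(\gamma,x,c)\models s$ iff $c(x)=s$; $\neg$ and $\bigvee$ are interpreted classically; $(\gamma,x,c)\models\langle m\rangle\varphi$ iff $(\gamma,\gamma_1(x)(m),c)\models\varphi$;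 $(\gamma,x,c)\models\bigcirc\varphi$ iff $(\gamma,x,G_\gamma(c))\models\varphi$. A logical transport $(\gamma,x_0)\rightsquigarrow(\delta,y_0)$ is a map $t\colon X^*\to Y^*$ such that for all formulas $\varphi$ and all $c\in X^*$: $(\gamma,x_0,c)\models\varphi$ iff $(\delta,y_0,t(c))\models\varphi$. -}

module Defs where

open import Data.Product using (Σ; ∃; _×_; _,_; proj₁; proj₂)
open import Relation.Binary.PropositionalEquality using (_≡_; cong)
open import Relation.Nullary using (¬_)
open import Function using (_∘_; _⇔_)
open import Function.Definitions using (Injective)

-- Everything is relative to a fixed monoid (M, _·_, e), a neighbourhood
-- given by its inclusion i : N → M, and a set of states S.
-- (The monoid laws and injectivity of i are hypotheses of the theorem.)
module CellularAutomata (M : Set) (_·_ : M → M → M) (e : M)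
                        (N : Set) (i : N → M) (S : Set) where

  Config : Set → Set
  Config X = X → S

  InI : {X : Set} → (M → X) → (N → S) → Set
  InI a f = ∀ n n' → a (i n) ≡ a (i n') → f n ≡ f n'

  I : {X : Set} → (M → X) → Set
  I a = Σ (N → S) (InI a)

  C : Set → Set
  C X = Σ (M → X) (λ a → I a → S)

  pullI : {X Y : Set} (h : X → Y) (a : M → X) (b : M → Y) →
          (∀ m → h (a m) ≡ b m) → I b → I a
  pullI h a b eq (f , p) =
    f , λ n n' q → p n n' (Relation.Binary.PropositionalEquality.trans
                             (Relation.Binary.PropositionalEquality.sym (eq (i n)))
                             (Relation.Binary.PropositionalEquality.trans (cong h q) (eq (i n'))))

  Cmap : {X Y : Set} → (X → Y) → C X → C Y
  Cmap h (a , φ) = h ∘ a , λ g → φ (pullI h a (h ∘ a) (λ _ → Relation.Binary.PropositionalEquality.refl) g)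

  -- Elements of I^a are functions with a
  -- membership proof; since [I^a , S] is a set of functions on a *set* of
  -- maps, γ₂ x is required to be well defined, i.e. to depend only on the
  -- underlying map N → S (extensionally).
  record CA (X : Set) : Set where
    field
      γ : X → C X

    γ₁ : X → M → X
    γ₁ x = proj₁ (γ x)

    γ₂ : (x : X) → I (γ₁ x) → S
    γ₂ x = proj₂ (γ x)

    field
      γ₂-welldef : ∀ x (f g : I (γ₁ x)) →
                   (∀ n → proj₁ f n ≡ proj₁ g n) → γ₂ x f ≡ γ₂ x g
      unit : ∀ x → γ₁ x e ≡ x
      act  : ∀ x m n → γ₁ (γ₁ x m) n ≡ γ₁ x (n · m)

  open CA public

  G : {X : Set} → CA X → Config X → Config X
  G γ c x = γ₂ γ x (c ∘ γ₁ γ x ∘ i , λ n n' q → cong c q)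

  -- pre-cellular morphisms h : γ → δ  (C h ∘ γ = δ ∘ h, componentwise)
  record IsPreCellular {X Y : Set} (γ : CA X) (δ : CA Y) (h : X → Y) : Set where
    field
      comm₁ : ∀ x m → h (γ₁ γ x m) ≡ γ₁ δ (h x) m
      comm₂ : ∀ x (g : I (γ₁ δ (h x))) →
              γ₂ δ (h x) g ≡ γ₂ γ x (pullI h (γ₁ γ x) (γ₁ δ (h x)) (comm₁ x) g)

  IsCellular : {X Y : Set} (γ : CA X) (δ : CA Y) →
               (X → Y) → (Config X → Config Y) → Set
  IsCellular γ δ f s = IsPreCellular γ δ f × (∀ c x → s c (f x) ≡ c x)

  IsBasedCellular : {X Y : Set} (γ : CA X) (x₀ : X) (δ : CA Y) (y₀ : Y) →
                    (X → Y) → (Config X → Config Y) → Set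
  IsBasedCellular γ x₀ δ y₀ f s = IsCellular γ δ f s × f x₀ ≡ y₀

  Reachable : {X : Set} → CA X → X → Set
  Reachable γ x₀ = ∀ x → ∃ λ m → γ₁ γ x₀ m ≡ x

  Free : {X : Set} → CA X → Set
  Free γ = ∀ x → Injective _≡_ _≡_ (γ₁ γ x)

  data Formula : Set₁ where
    atom : S → Formula
    neg  : Formula → Formula
    disj : {J : Set} → (J → Formula) → Formula
    dia  : M → Formula → Formula
    next : Formula → Formula

  Sat : {X : Set} → CA X → X → Config X → Formula → Set
  Sat γ x c (atom s)       = c x ≡ s
  Sat γ x c (neg φ)        = ¬ Sat γ x c φ
  Sat γ x c (disj {J} φs)  = Σ J (λ j → Sat γ x c (φs j))
  Sat γ x c (dia m φ)      = Sat γ (γ₁ γ x m) c φ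
  Sat γ x c (next φ)       = Sat γ x (G γ c) φ

  IsLogicalTransport : {X Y : Set} (γ : CA X) (x₀ : X) (δ : CA Y) (y₀ : Y) →
                       (Config X → Config Y) → Set₁
  IsLogicalTransport γ x₀ δ y₀ t =
    ∀ (φ : Formula) (c : Config _) → Sat γ x₀ c φ ⇔ Sat δ y₀ (t c) φ

{-# OPTIONS --safe #-}
module Submission where

-- Basedness and the first commutation law force f(γ₁(x₀)(m)) = δ₁(y₀)(m),
-- which determines f since γ is reachable; freeness makes this formula a
-- well-defined map.  Transporting the formulas ⟨m⟩ s and ⟨m⟩ ○ s gives
-- t c ∘ f = c and G_δ (t c) ∘ f = G_γ c.  Every g ∈ I^{δ₁(f x)} is the
-- restriction c ∘ γ₁(x) ∘ i of some configuration c (this uses excluded middle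
-- and S ≠ ∅), so the second equation yields the γ₂-part of the pre-cellular
-- condition.

open import Defs
open import Data.Empty using (⊥-elim)
open import Data.Product using (Σ; _×_; _,_; proj₁; proj₂)
open import Relation.Binary.PropositionalEquality
  using (_≡_; refl; sym; cong; subst; module ≡-Reasoning)
open import Relation.Nullary using (Dec; yes; no)
open import Function using (_∘_)
open import Function.Bundles using (Equivalence)
open import Function.Definitions using (Injective)
open import Algebra.Structures using (IsMonoid)

factor-through : ((P : Set) → Dec P) → {N X S : Set} → S →
                 (k : N → X) (g : N → S) → (∀ n n' → k n ≡ k n' → g n ≡ g n') →
                 Σ (X → S) λ c → ∀ n → c (k n) ≡ g n
factor-through lem {N} {X} {S} s₀ k g g-resp = c , c∘k≡g
  where
  c : X → S
  c x with lem (Σ N λ n → k n ≡ x)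
  ... | yes (n , _) = g n
  ... | no _        = s₀

  c∘k≡g : ∀ n → c (k n) ≡ g n
  c∘k≡g n with lem (Σ N λ n' → k n' ≡ k n)
  ... | yes (n' , kn'≡kn) = g-resp n' n kn'≡kn
  ... | no ∄n'            = ⊥-elim (∄n' (n , refl))

module CellularTheory (M : Set) (_·_ : M → M → M) (e : M)
                      (N : Set) (i : N → M) (S : Set) where
  open CellularAutomata M _·_ e N i S

  module _ (lem : (P : Set) → Dec P) (s₀ : S)
           {X Y : Set} (γ : CA X) (δ : CA Y) (h : X → Y)
           (comm₁ : ∀ x m → h (γ₁ γ x m) ≡ γ₁ δ (h x) m)
           (s : Config X → Config Y) (section : ∀ c x → s c (h x) ≡ c x)
           (G-comm : ∀ c x → G δ (s c) (h x) ≡ G γ c x) where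

    isPreCellular-fromSection : IsPreCellular γ δ h
    isPreCellular-fromSection = record { comm₁ = comm₁ ; comm₂ = comm₂ }
      where
      comm₂ : ∀ x (g : I (γ₁ δ (h x))) →
              γ₂ δ (h x) g ≡ γ₂ γ x (pullI h (γ₁ γ x) (γ₁ δ (h x)) (comm₁ x) g)
      comm₂ x g = begin
          γ₂ δ (h x) g     ≡⟨ γ₂-welldef δ (h x) g _ (sym ∘ s-c-restricts-to-g) ⟩
          G δ (s c) (h x)  ≡⟨ G-comm c x ⟩
          G γ c x          ≡⟨ γ₂-welldef γ x _ _ c-restricts-to-g ⟩
          γ₂ γ x (pullI h (γ₁ γ x) (γ₁ δ (h x)) (comm₁ x) g)  ∎
        where
        open ≡-Reasoning
        g-resp : ∀ n n' → γ₁ γ x (i n) ≡ γ₁ γ x (i n') → proj₁ g n ≡ proj₁ g n'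
        g-resp n n' eq = proj₂ g n n' (begin
          γ₁ δ (h x) (i n)     ≡⟨ sym (comm₁ x (i n)) ⟩
          h (γ₁ γ x (i n))     ≡⟨ cong h eq ⟩
          h (γ₁ γ x (i n'))    ≡⟨ comm₁ x (i n') ⟩
          γ₁ δ (h x) (i n')    ∎)

        c : Config X
        c = proj₁ (factor-through lem s₀ (γ₁ γ x ∘ i) (proj₁ g) g-resp)

        c-restricts-to-g : ∀ n → c (γ₁ γ x (i n)) ≡ proj₁ g n
        c-restricts-to-g = proj₂ (factor-through lem s₀ (γ₁ γ x ∘ i) (proj₁ g) g-resp)

        s-c-restricts-to-g : ∀ n → s c (γ₁ δ (h x) (i n)) ≡ proj₁ g n
        s-c-restricts-to-g n = begin
          s c (γ₁ δ (h x) (i n))  ≡⟨ cong (s c) (sym (comm₁ x (i n))) ⟩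
          s c (h (γ₁ γ x (i n)))  ≡⟨ section c _ ⟩
          c (γ₁ γ x (i n))        ≡⟨ c-restricts-to-g n ⟩
          proj₁ g n               ∎

  module Orbit {X : Set} (γ : CA X) (x₀ : X) (reach : Reachable γ x₀) where

    orbit-ind : (P : X → Set) → (∀ m → P (γ₁ γ x₀ m)) → ∀ x → P x
    orbit-ind P P-orbit x = subst P (proj₂ (reach x)) (P-orbit (proj₁ (reach x)))

    orbit-lift : {Y : Set} → (M → Y) → X → Y
    orbit-lift a x = a (proj₁ (reach x))

    orbit-lift-β : Free γ → {Y : Set} (a : M → Y) → ∀ m → orbit-lift a (γ₁ γ x₀ m) ≡ a m
    orbit-lift-β free a m = cong a (free x₀ (proj₂ (reach (γ₁ γ x₀ m))))

  module Based {X Y : Set} (γ : CA X) (x₀ : X) (δ : CA Y) (y₀ : Y) where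

    OrbitCompatible : (X → Y) → Set
    OrbitCompatible h = ∀ m → h (γ₁ γ x₀ m) ≡ γ₁ δ y₀ m

    orbitCompatible⇒based : ∀ h → OrbitCompatible h → h x₀ ≡ y₀
    orbitCompatible⇒based h h-orbit = begin
      h x₀             ≡⟨ cong h (sym (unit γ x₀)) ⟩
      h (γ₁ γ x₀ e)    ≡⟨ h-orbit e ⟩
      γ₁ δ y₀ e        ≡⟨ unit δ y₀ ⟩
      y₀               ∎
      where open ≡-Reasoning

    based-preCellular⇒orbitCompatible : ∀ h → IsPreCellular γ δ h → h x₀ ≡ y₀ →
                                        OrbitCompatible h
    based-preCellular⇒orbitCompatible h h-pre h-based m = begin
      h (γ₁ γ x₀ m)  ≡⟨ IsPreCellular.comm₁ h-pre x₀ m ⟩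
      γ₁ δ (h x₀) m  ≡⟨ cong (λ y → γ₁ δ y m) h-based ⟩
      γ₁ δ y₀ m      ∎
      where open ≡-Reasoning

    orbitCompatible-unique : Reachable γ x₀ → ∀ h h' →
                             OrbitCompatible h → OrbitCompatible h' → ∀ x → h' x ≡ h x
    orbitCompatible-unique reach h h' h-orbit h'-orbit =
      Orbit.orbit-ind γ x₀ reach (λ x → h' x ≡ h x) λ m → begin
        h' (γ₁ γ x₀ m)  ≡⟨ h'-orbit m ⟩
        γ₁ δ y₀ m       ≡⟨ sym (h-orbit m) ⟩
        h (γ₁ γ x₀ m)   ∎
      where open ≡-Reasoning

    orbitCompatible⇒comm₁ : Reachable γ x₀ → ∀ h → OrbitCompatible h →
                            ∀ x m → h (γ₁ γ x m) ≡ γ₁ δ (h x) m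
    orbitCompatible⇒comm₁ reach h h-orbit x m =
      Orbit.orbit-ind γ x₀ reach (λ x → h (γ₁ γ x m) ≡ γ₁ δ (h x) m) comm₁-on-orbit x
      where
      open ≡-Reasoning
      comm₁-on-orbit : ∀ m₀ → h (γ₁ γ (γ₁ γ x₀ m₀) m) ≡ γ₁ δ (h (γ₁ γ x₀ m₀)) m
      comm₁-on-orbit m₀ = begin
        h (γ₁ γ (γ₁ γ x₀ m₀) m)   ≡⟨ cong h (act γ x₀ m₀ m) ⟩
        h (γ₁ γ x₀ (m · m₀))      ≡⟨ h-orbit (m · m₀) ⟩
        γ₁ δ y₀ (m · m₀)          ≡⟨ sym (act δ y₀ m₀ m) ⟩
        γ₁ δ (γ₁ δ y₀ m₀) m       ≡⟨ cong (λ y → γ₁ δ y m) (sym (h-orbit m₀)) ⟩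
        γ₁ δ (h (γ₁ γ x₀ m₀)) m   ∎

    module Transport (reach : Reachable γ x₀) (h : X → Y) (h-orbit : OrbitCompatible h)
             {t : Config X → Config Y} (transport : IsLogicalTransport γ x₀ δ y₀ t) where

      transport-along-orbit : ∀ m φ c → Sat γ (γ₁ γ x₀ m) c φ → Sat δ (γ₁ δ y₀ m) (t c) φ
      transport-along-orbit m φ c = Equivalence.to (transport (dia m φ) c)

      transport-section : ∀ c x → t c (h x) ≡ c x
      transport-section c = Orbit.orbit-ind γ x₀ reach (λ x → t c (h x) ≡ c x) λ m →
        subst (λ y → t c y ≡ c (γ₁ γ x₀ m)) (sym (h-orbit m))
              (transport-along-orbit m (atom (c (γ₁ γ x₀ m))) c refl)

      transport-G : ∀ c x → G δ (t c) (h x) ≡ G γ c x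
      transport-G c = Orbit.orbit-ind γ x₀ reach (λ x → G δ (t c) (h x) ≡ G γ c x) λ m →
        subst (λ y → G δ (t c) y ≡ G γ c (γ₁ γ x₀ m)) (sym (h-orbit m))
              (transport-along-orbit m (next (atom (G γ c (γ₁ γ x₀ m)))) c refl)

theorem3 :
    -- ambient classical logic (the paper works in classical set theory)
    (lem : (P : Set) → Dec P) →
    (M : Set) (_·_ : M → M → M) (e : M) → IsMonoid _≡_ _·_ e →
    (N : Set) (i : N → M) → Injective _≡_ _≡_ i →
    (S : Set) → S →
    let open CellularAutomata M _·_ e N i S in
    {X Y : Set} (γ : CA X) (x₀ : X) (δ : CA Y) (y₀ : Y) →
    Reachable γ x₀ → Reachable δ y₀ → Free γ →
    (t : Config X → Config Y) → IsLogicalTransport γ x₀ δ y₀ t →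
    Σ (X → Y) (λ f → IsBasedCellular γ x₀ δ y₀ f t
      × (∀ (f' : X → Y) → IsBasedCellular γ x₀ δ y₀ f' t → ∀ x → f' x ≡ f x))
theorem3 lem M _·_ e _ N i _ S s₀ {X} {Y} γ x₀ δ y₀ reach _ free t transport =
  f , ((f-preCellular , transport-section) , orbitCompatible⇒based f f-orbit) , f-unique
  where
  open CellularAutomata M _·_ e N i S hiding (γ)
  open CellularTheory M _·_ e N i S
  open Orbit γ x₀ reach
  open Based γ x₀ δ y₀

  f : X → Y
  f = orbit-lift (γ₁ δ y₀)

  f-orbit : OrbitCompatible f
  f-orbit = orbit-lift-β free (γ₁ δ y₀)

  open Transport reach f f-orbit transport

  f-preCellular : IsPreCellular γ δ f
  f-preCellular = isPreCellular-fromSection lem s₀ γ δ f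
    (orbitCompatible⇒comm₁ reach f f-orbit) t transport-section transport-G

  f-unique : ∀ f' → IsBasedCellular γ x₀ δ y₀ f' t → ∀ x → f' x ≡ f x
  f-unique f' ((f'-preCellular , _) , f'-based) =
    orbitCompatible-unique reach f f' f-orbit
      (based-preCellular⇒orbitCompatible f' f'-preCellular f'-based)
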